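{- Let $k\ge2$ be an integer, $c\in(0,1/2)$, $n\ge r\ge1$ integers, and $w_1,\ldots,w_k$ weighted $r$-uniform hypergraphs on $[n]$ with $w_i^*([n]\setminus\{j\})\ge1-c$ for all $i\in[k]$ and $j\in[n]$. For $S\subseteq[n]$ let $\varphi(S)\in\mathbb{R}^{k-1}$ be the vector whose $i$-th coordinate is $w_i^*(S)-w_k^*(S)$, $i\in[k-1]$. If $S$ is a nonempty subset of $[n]$, then \[\frac{1}{|S|}\sum_{j\in S}\|\varphi(S\setminus\{j\})\|^2\le\|\varphi(S)\|^2-\frac{2r}{|S|}\big(\|\varphi(S)\|^2-(k-1)c\big).\]
   Context: $[n]=\{1,\ldots,n\}$. For a finite set $S$, $S^{(r)}$ is the family of all $r$-element subsets of $S$. A weighted $r$-uniform hypergraph on $[n]$ is a function $w\colon[n]^{(r)}\to\mathbb{R}_{\ge0}$ with $\sum_{R\in[n]^{(r)}}w(R)=1$. For $S\subseteq[n]$, $w^*(S):=\sum_{R\in S^{(r)}}w(R)$. $\|\cdot\|$ is the Euclidean norm on $\mathbb{R}^{k-1}$. -}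

module Defs where

open import Level using (Level; _⊔_)
open import Data.Nat as ℕ using (ℕ; zero; suc)
open import Data.Bool using (Bool; true; false; if_then_else_; _∧_)
open import Data.Fin using (Fin; zero; suc; inject₁; fromℕ)
open import Data.Vec using ([]; _∷_)
open import Data.List using (List; []; _∷_; map; _++_; foldr)
open import Data.Fin.Subset using (Subset; inside; outside; ∣_∣; _─_; ⁅_⁆)
open import Data.Fin.Subset.Properties using (_∈?_; _⊆?_)
open import Relation.Nullary.Decidable using (⌊_⌋)
open import Relation.Binary.Structures using (IsTotalOrder)
open import Relation.Nullary using (¬_)
open import Algebra.Bundles using (CommutativeRing)

-- A (nontrivial) totally ordered commutative ring.  ℝ is an instance.
-- The statement is formulated over an arbitrary such ring.

record OrderedCommRing (a ℓ₁ ℓ₂ : Level) : Set (Level.suc (a ⊔ ℓ₁ ⊔ ℓ₂)) where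
  field
    commutativeRing : CommutativeRing a ℓ₁
  open CommutativeRing commutativeRing public
    using (Carrier; _≈_; _+_; _*_; -_; _-_; 0#; 1#)
  infix 4 _≤_
  field
    _≤_          : Carrier → Carrier → Set ℓ₂
    isTotalOrder : IsTotalOrder _≈_ _≤_
    +-monoˡ-≤    : ∀ {x y} z → x ≤ y → x + z ≤ y + z
    *-nonneg     : ∀ {x y} → 0# ≤ x → 0# ≤ y → 0# ≤ x * y
    nontrivial   : ¬ (1# ≈ 0#)

  infix 4 _<_
  _<_ : Carrier → Carrier → Set (ℓ₁ ⊔ ℓ₂)
  x < y = (x ≤ y) Data.Product.× (¬ (x ≈ y))
    where import Data.Product

  fromℕ' : ℕ → Carrier
  fromℕ' zero    = 0#
  fromℕ' (suc n) = 1# + fromℕ' n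

  sumL : List Carrier → Carrier
  sumL = foldr _+_ 0#

  ΣFin : ∀ {m} → (Fin m → Carrier) → Carrier
  ΣFin {zero}  f = 0#
  ΣFin {suc m} f = f zero + ΣFin (λ i → f (suc i))

  _² : Carrier → Carrier
  x ² = x * x

allSubsets : ∀ n → List (Subset n)
allSubsets zero    = [] ∷ []
allSubsets (suc n) = map (outside ∷_) (allSubsets n) ++ map (inside ∷_) (allSubsets n)

module _ {a ℓ₁ ℓ₂} (𝔽 : OrderedCommRing a ℓ₁ ℓ₂) where
  open OrderedCommRing 𝔽

  -- A weighted r-uniform hypergraph on [n]: a function on r-subsets of [n]
  -- (represented as a function on all subsets, of which only the values
  -- on r-element subsets are ever used), nonnegative, total weight 1.
  IsWeightedHypergraph : (n r : ℕ) → (Subset n → Carrier) → Set (ℓ₁ ⊔ ℓ₂)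
  IsWeightedHypergraph n r w =
    (∀ (R : Subset n) → ∣ R ∣ Relation.Binary.PropositionalEquality.≡ r → 0# ≤ w R)
    Data.Product.×
    (sumL (map (λ R → if ⌊ ∣ R ∣ ℕ.≟ r ⌋ then w R else 0#) (allSubsets n)) ≈ 1#)
    where import Data.Product
          import Relation.Binary.PropositionalEquality

  wStar : ∀ {n} (r : ℕ) → (Subset n → Carrier) → Subset n → Carrier
  wStar {n} r w S =
    sumL (map (λ R → if ⌊ ∣ R ∣ ℕ.≟ r ⌋ ∧ ⌊ R ⊆? S ⌋ then w R else 0#) (allSubsets n))

  -- k = suc m hypergraphs w₀,…,w_m; φ(S)_i = w_i*(S) - w_k*(S), i ∈ [k-1]
  φ : ∀ {n m} (r : ℕ) → (Fin (suc m) → Subset n → Carrier) → Subset n → Fin m → Carrier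
  φ {m = m} r w S i = wStar r (w (inject₁ i)) S - wStar r (w (fromℕ m)) S

  normSq : ∀ {n m} (r : ℕ) → (Fin (suc m) → Subset n → Carrier) → Subset n → Carrier
  normSq r w S = ΣFin (λ i → (φ r w S i) ²)

  sumRemove : ∀ {n m} (r : ℕ) → (Fin (suc m) → Subset n → Carrier) → Subset n → Carrier
  sumRemove r w S = ΣFin (λ j → if ⌊ j ∈? S ⌋ then normSq r w (S ─ ⁅ j ⁆) else 0#)

module Submission where

-- Write p = φ(S), and for j ∈ S let x_ij and y_j be the weights of the r-subsets of S through j
-- in w_i and w_k, so that φ(S ∖ {j})_i = p_i − (x_ij − y_j).  Monotonicity and the hypothesis
-- w*([n] ∖ {j}) ≥ 1 − c give 0 ≤ x_ij, y_j ≤ c, and then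
--   (p − (x − y))² = p² + (c − 2p)x + (c + 2p)y − x(c − x) − y(c − y) − 2xy
--                ≤ p² + (c − 2p)x + (c + 2p)y.
-- Summing over j ∈ S counts every r-subset r times: Σ_j x_ij = r w_i*(S) and Σ_j y_j = r w_k*(S).
-- The linear terms thus become c r (w_i*(S) + w_k*(S)) − 2r p_i² ≤ 2rc − 2r p_i², and summing over i
-- yields the bound, multiplied through by |S|.

open import Defs
open import Level using (Level)
open import Data.Nat as ℕ using (ℕ; suc)
open import Data.Fin using (Fin)
open import Data.Fin.Subset using (Subset; ⊤; _─_; ⁅_⁆; ∣_∣; Nonempty)

open import Data.Bool using (Bool; true; false; if_then_else_; _∧_)
open import Data.Empty using (⊥-elim)
open import Data.Fin using (zero; suc; inject₁; fromℕ)
open import Data.Fin.Subset using (inside; outside; _∈_; _∉_; _⊆_)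
open import Data.Fin.Subset.Properties
  using (_∈?_; _⊆?_; ⊆⊤; ⊆-trans; p─q⊆p; x∈p∧x∉q⇒x∈p─q; x∈⁅x⁆; x∈⁅y⁆⇒x≡y)
open import Data.Integer as ℤ using (ℤ)
open import Data.Integer.Properties using ([1+m]⊖[1+n]≡m⊖n)
open import Data.List using (List; []; _∷_; map)
open import Data.Maybe using (Maybe; just; nothing)
open import Data.Nat.Properties using (+-suc)
open import Data.Product using (_×_; _,_; proj₁; proj₂)
open import Data.Sum using (inj₁; inj₂)
open import Data.Sign as Sign using (Sign)
open import Data.Vec using ([]; _∷_; here; there)
open import Function.Bundles using (_⇔_; mk⇔; Equivalence)
open import Algebra.Bundles using (CommutativeRing)
import Algebra.Solver.Ring as RingSolver
open import Algebra.Solver.Ring.AlmostCommutativeRing using (fromCommutativeRing; _-Raw-AlmostCommutative⟶_)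
open import Relation.Binary.Bundles using (Poset)
open import Relation.Binary.PropositionalEquality as ≡ using (_≡_)
open import Relation.Binary.Structures using (IsTotalOrder)
open import Relation.Nullary using (yes; no)
open import Relation.Nullary.Decidable using (⌊_⌋)

-- The ring solver needs coefficients with decidable equality; ℤ maps into every commutative ring.
module IntegerCoefficientSolver {c ℓ} (R : CommutativeRing c ℓ) where
  open CommutativeRing R
  open import Algebra.Properties.Ring ring using (-‿involutive; -0#≈0#; -1*x≈-x; -‿+-comm)
  open import Algebra.Properties.Semiring.Mult semiring using (×-homo-+; ×1-homo-*) renaming (_×_ to _·_)
  open import Algebra.Properties.CommutativeSemigroup +-commutativeSemigroup
    using () renaming (interchange to +-interchange)
  open import Algebra.Properties.CommutativeSemigroup *-commutativeSemigroup
    using () renaming (interchange to *-interchange)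
  open import Relation.Binary.Reasoning.Setoid setoid

  private
    ⟦_⟧ : ℤ → Carrier
    ⟦ ℤ.+ n ⟧      = n · 1#
    ⟦ ℤ.-[1+ n ] ⟧ = - (suc n · 1#)

    ⟦_⟧ₛ : Sign → Carrier
    ⟦ Sign.+ ⟧ₛ = 1#
    ⟦ Sign.- ⟧ₛ = - 1#

    ⟦◃⟧ : ∀ s n → ⟦ s ℤ.◃ n ⟧ ≈ ⟦ s ⟧ₛ * (n · 1#)
    ⟦◃⟧ s      0       = sym (zeroʳ _)
    ⟦◃⟧ Sign.+ (suc n) = sym (*-identityˡ _)
    ⟦◃⟧ Sign.- (suc n) = sym (-1*x≈-x _)

    ⟦sign◃∣∣⟧ : ∀ i → ⟦ i ⟧ ≈ ⟦ ℤ.sign i ⟧ₛ * (ℤ.∣ i ∣ · 1#)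
    ⟦sign◃∣∣⟧ (ℤ.+ n)      = sym (*-identityˡ _)
    ⟦sign◃∣∣⟧ ℤ.-[1+ n ]   = sym (-1*x≈-x _)

    ⟦*⟧ₛ : ∀ s t → ⟦ s Sign.* t ⟧ₛ ≈ ⟦ s ⟧ₛ * ⟦ t ⟧ₛ
    ⟦*⟧ₛ Sign.+ t      = sym (*-identityˡ _)
    ⟦*⟧ₛ Sign.- Sign.+ = sym (*-identityʳ _)
    ⟦*⟧ₛ Sign.- Sign.- = sym (trans (-1*x≈-x _) (-‿involutive _))

    shift-sub : ∀ a x y → x - y ≈ (a + x) - (a + y)
    shift-sub a x y = begin
      x - y                   ≈⟨ +-identityˡ _ ⟨
      0# + (x - y)            ≈⟨ +-congʳ (-‿inverseʳ a) ⟨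
      (a - a) + (x - y)       ≈⟨ +-interchange _ _ _ _ ⟩
      (a + x) + (- a + - y)   ≈⟨ +-congˡ (-‿+-comm a y) ⟩
      (a + x) - (a + y)       ∎

    ⟦⊖⟧ : ∀ m n → ⟦ m ℤ.⊖ n ⟧ ≈ m · 1# - n · 1#
    ⟦⊖⟧ m       0       = trans (sym (+-identityʳ _)) (+-congˡ (sym -0#≈0#))
    ⟦⊖⟧ 0       (suc n) = sym (+-identityˡ _)
    ⟦⊖⟧ (suc m) (suc n) = begin
      ⟦ suc m ℤ.⊖ suc n ⟧  ≡⟨ ≡.cong ⟦_⟧ ([1+m]⊖[1+n]≡m⊖n m n) ⟩
      ⟦ m ℤ.⊖ n ⟧          ≈⟨ ⟦⊖⟧ m n ⟩
      m · 1# - n · 1#      ≈⟨ shift-sub 1# _ _ ⟩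
      suc m · 1# - suc n · 1# ∎

    ⟦+⟧ : ∀ i j → ⟦ i ℤ.+ j ⟧ ≈ ⟦ i ⟧ + ⟦ j ⟧
    ⟦+⟧ ℤ.-[1+ m ] ℤ.-[1+ n ] = begin
      - (suc (suc (m ℕ.+ n)) · 1#)     ≡⟨ ≡.cong (λ k → - (suc k · 1#)) (+-suc m n) ⟨
      - ((suc m ℕ.+ suc n) · 1#)       ≈⟨ -‿cong (×-homo-+ 1# (suc m) (suc n)) ⟩
      - (suc m · 1# + suc n · 1#)      ≈⟨ -‿+-comm _ _ ⟨
      - (suc m · 1#) + - (suc n · 1#)  ∎
    ⟦+⟧ ℤ.-[1+ m ] (ℤ.+ n)    = trans (⟦⊖⟧ n (suc m)) (+-comm _ _)
    ⟦+⟧ (ℤ.+ m)    ℤ.-[1+ n ] = ⟦⊖⟧ m (suc n)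
    ⟦+⟧ (ℤ.+ m)    (ℤ.+ n)    = ×-homo-+ 1# m n

    ⟦*⟧ : ∀ i j → ⟦ i ℤ.* j ⟧ ≈ ⟦ i ⟧ * ⟦ j ⟧
    ⟦*⟧ i j = begin
      ⟦ (ℤ.sign i Sign.* ℤ.sign j) ℤ.◃ (ℤ.∣ i ∣ ℕ.* ℤ.∣ j ∣) ⟧
        ≈⟨ ⟦◃⟧ (ℤ.sign i Sign.* ℤ.sign j) (ℤ.∣ i ∣ ℕ.* ℤ.∣ j ∣) ⟩
      ⟦ ℤ.sign i Sign.* ℤ.sign j ⟧ₛ * ((ℤ.∣ i ∣ ℕ.* ℤ.∣ j ∣) · 1#)
        ≈⟨ *-cong (⟦*⟧ₛ (ℤ.sign i) (ℤ.sign j)) (×1-homo-* ℤ.∣ i ∣ ℤ.∣ j ∣) ⟩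
      (⟦ ℤ.sign i ⟧ₛ * ⟦ ℤ.sign j ⟧ₛ) * ((ℤ.∣ i ∣ · 1#) * (ℤ.∣ j ∣ · 1#))
        ≈⟨ *-interchange _ _ _ _ ⟩
      (⟦ ℤ.sign i ⟧ₛ * (ℤ.∣ i ∣ · 1#)) * (⟦ ℤ.sign j ⟧ₛ * (ℤ.∣ j ∣ · 1#))
        ≈⟨ *-cong (⟦sign◃∣∣⟧ i) (⟦sign◃∣∣⟧ j) ⟨
      ⟦ i ⟧ * ⟦ j ⟧ ∎

    ⟦-⟧ : ∀ i → ⟦ ℤ.- i ⟧ ≈ - ⟦ i ⟧
    ⟦-⟧ ℤ.-[1+ n ]    = sym (-‿involutive _)
    ⟦-⟧ (ℤ.+ 0)       = sym -0#≈0#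
    ⟦-⟧ (ℤ.+ (suc n)) = refl

    decide : ∀ i j → Maybe (⟦ i ⟧ ≈ ⟦ j ⟧)
    decide i j with i ℤ.≟ j
    ... | yes ≡.refl = just refl
    ... | no _       = nothing

    integerCoefficients : ℤ.+-*-rawRing -Raw-AlmostCommutative⟶ fromCommutativeRing R
    integerCoefficients = record
      { ⟦_⟧ = ⟦_⟧ ; +-homo = ⟦+⟧ ; *-homo = ⟦*⟧ ; -‿homo = ⟦-⟧
      ; 0-homo = refl ; 1-homo = +-identityʳ 1# }

  open RingSolver ℤ.+-*-rawRing (fromCommutativeRing R) integerCoefficients decide public
    using (solve; _:=_; _:+_; _:*_; :-_; _:-_)

-- ⌊_⌋ matches on the Dec, so it does not compute through the Dec.map′ in the definition of _∈?_.
⌊suc∈?∷⌋ : ∀ {k} (j : Fin k) s (R : Subset k) → ⌊ suc j ∈? s ∷ R ⌋ ≡ ⌊ j ∈? R ⌋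
⌊suc∈?∷⌋ j s R with j ∈? R
... | yes _ = ≡.refl
... | no  _ = ≡.refl

x∈p─q⇒x∉q : ∀ {k} {x : Fin k} (p q : Subset k) → x ∈ p ─ q → x ∉ q
x∈p─q⇒x∉q (_ ∷ p) (outside ∷ q) here       ()
x∈p─q⇒x∉q (_ ∷ p) (_       ∷ q) (there x∈) (there x∈q) = x∈p─q⇒x∉q p q x∈ x∈q

⊆─⁅⁆⇔ : ∀ {k} {R S : Subset k} {j : Fin k} → R ⊆ S ─ ⁅ j ⁆ ⇔ (R ⊆ S × j ∉ R)
⊆─⁅⁆⇔ {R = R} {S} {j} = mk⇔
  (λ R⊆S-j → (λ {_} x∈R → p─q⊆p S ⁅ j ⁆ (R⊆S-j x∈R))
           , (λ j∈R → x∈p─q⇒x∉q S ⁅ j ⁆ (R⊆S-j j∈R) (x∈⁅x⁆ j)))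
  (λ (R⊆S , j∉R) {x} x∈R →
     x∈p∧x∉q⇒x∈p─q (R⊆S x∈R) (λ x∈⁅j⁆ → j∉R (≡.subst (_∈ R) (x∈⁅y⁆⇒x≡y j x∈⁅j⁆) x∈R)))

module _ {a ℓ₁ ℓ₂} (𝔽 : OrderedCommRing a ℓ₁ ℓ₂) where
  open OrderedCommRing 𝔽
  open CommutativeRing commutativeRing
    using (refl; sym; trans; reflexive; +-cong; +-congˡ; +-congʳ; *-cong; *-congˡ; *-congʳ; -‿cong;
           +-assoc; +-comm; +-identityˡ; +-identityʳ; *-identityˡ; *-identityʳ; zeroˡ; zeroʳ;
           distribˡ; distribʳ; -‿inverseʳ; semiring; +-commutativeSemigroup)
  open import Algebra.Properties.CommutativeSemigroup +-commutativeSemigroup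
    using () renaming (interchange to +-interchange)
  open import Algebra.Properties.Semiring.Sum semiring
    using (sum; sum-syntax; ∑-distrib-+; ∑-comm; *-distribˡ-sum; sum-cong-≋; sum-cong-≗; sum-replicate-zero)
  open IntegerCoefficientSolver commutativeRing
  open IsTotalOrder isTotalOrder using (isPartialOrder; total)
    renaming (refl to ≤-refl; reflexive to ≤-reflexive; trans to ≤-trans)

  poset : Poset a ℓ₁ ℓ₂
  poset = record { isPartialOrder = isPartialOrder }

  open import Relation.Binary.Reasoning.PartialOrder poset

  +-monoʳ-≤ : ∀ {x y} z → x ≤ y → z + x ≤ z + y
  +-monoʳ-≤ {x} {y} z x≤y = begin
    z + x  ≈⟨ +-comm z x ⟩
    x + z  ≤⟨ +-monoˡ-≤ z x≤y ⟩
    y + z  ≈⟨ +-comm y z ⟩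
    z + y  ∎

  +-mono-≤ : ∀ {x y u v} → x ≤ y → u ≤ v → x + u ≤ y + v
  +-mono-≤ {x} {y} {u} {v} x≤y u≤v = begin
    x + u  ≤⟨ +-monoˡ-≤ u x≤y ⟩
    y + u  ≤⟨ +-monoʳ-≤ y u≤v ⟩
    y + v  ∎

  x≤y⇒0≤y-x : ∀ {x y} → x ≤ y → 0# ≤ y - x
  x≤y⇒0≤y-x {x} {y} x≤y = begin
    0#     ≈⟨ -‿inverseʳ x ⟨
    x - x  ≤⟨ +-monoˡ-≤ (- x) x≤y ⟩
    y - x  ∎

  0≤y-x⇒x≤y : ∀ {x y} → 0# ≤ y - x → x ≤ y
  0≤y-x⇒x≤y {x} {y} 0≤y-x = begin
    x            ≈⟨ +-identityˡ x ⟨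
    0# + x       ≤⟨ +-monoˡ-≤ x 0≤y-x ⟩
    (y - x) + x  ≈⟨ solve 2 (λ x y → (y :- x) :+ x := y) refl x y ⟩
    y            ∎

  +-nonneg : ∀ {x y} → 0# ≤ x → 0# ≤ y → 0# ≤ x + y
  +-nonneg 0≤x 0≤y = ≤-trans (≤-reflexive (sym (+-identityˡ 0#))) (+-mono-≤ 0≤x 0≤y)

  *-monoˡ-≤-nonneg : ∀ {x y z} → 0# ≤ z → x ≤ y → z * x ≤ z * y
  *-monoˡ-≤-nonneg {x} {y} {z} 0≤z x≤y = 0≤y-x⇒x≤y (begin
    0#             ≤⟨ *-nonneg 0≤z (x≤y⇒0≤y-x x≤y) ⟩
    z * (y - x)    ≈⟨ solve 3 (λ x y z → z :* (y :- x) := z :* y :- z :* x) refl x y z ⟩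
    z * y - z * x  ∎)

  x²-nonneg : ∀ x → 0# ≤ x ²
  x²-nonneg x with total 0# x
  ... | inj₁ 0≤x = *-nonneg 0≤x 0≤x
  ... | inj₂ x≤0 = begin
    0#             ≤⟨ *-nonneg 0≤-x 0≤-x ⟩
    (- x) * (- x)  ≈⟨ solve 1 (λ x → (:- x) :* (:- x) := x :* x) refl x ⟩
    x ²            ∎
    where
    0≤-x : 0# ≤ - x
    0≤-x = ≤-trans (x≤y⇒0≤y-x x≤0) (≤-reflexive (+-identityˡ (- x)))

  0≤1 : 0# ≤ 1#
  0≤1 = ≤-trans (x²-nonneg 1#) (≤-reflexive (*-identityʳ 1#))

  fromℕ'-nonneg : ∀ k → 0# ≤ fromℕ' k
  fromℕ'-nonneg ℕ.zero    = ≤-refl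
  fromℕ'-nonneg (suc k) = +-nonneg 0≤1 (fromℕ'-nonneg k)

  fromℕ'-+ : ∀ k l → fromℕ' (k ℕ.+ l) ≈ fromℕ' k + fromℕ' l
  fromℕ'-+ ℕ.zero  l = sym (+-identityˡ _)
  fromℕ'-+ (suc k) l = trans (+-congˡ (fromℕ'-+ k l)) (sym (+-assoc 1# _ _))

  ΣFin≡sum : ∀ {k} (f : Fin k → Carrier) → ΣFin f ≡ sum f
  ΣFin≡sum {ℕ.zero} f = ≡.refl
  ΣFin≡sum {suc k}  f = ≡.cong (λ z → f zero + z) (ΣFin≡sum (λ i → f (suc i)))

  sum-mono-≤ : ∀ {k} {f g : Fin k → Carrier} → (∀ i → f i ≤ g i) → sum f ≤ sum g
  sum-mono-≤ {ℕ.zero} f≤g = ≤-refl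
  sum-mono-≤ {suc k}  f≤g = +-mono-≤ (f≤g zero) (sum-mono-≤ (λ i → f≤g (suc i)))

  sum-nonneg : ∀ {k} {f : Fin k → Carrier} → (∀ i → 0# ≤ f i) → 0# ≤ sum f
  sum-nonneg {k} 0≤f = ≤-trans (≤-reflexive (sym (sum-replicate-zero k))) (sum-mono-≤ 0≤f)

  sum-const : ∀ k x → ∑[ i < k ] x ≈ fromℕ' k * x
  sum-const ℕ.zero  x = sym (zeroˡ x)
  sum-const (suc k) x =
    trans (+-congˡ (sum-const k x)) (sym (trans (distribʳ x 1# (fromℕ' k)) (+-congʳ (*-identityˡ x))))

  module _ {A : Set} where
    sumL-map-cong : ∀ (L : List A) {f g : A → Carrier} → (∀ x → f x ≈ g x) → sumL (map f L) ≈ sumL (map g L)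
    sumL-map-cong []      f≈g = refl
    sumL-map-cong (x ∷ L) f≈g = +-cong (f≈g x) (sumL-map-cong L f≈g)

    sumL-map-+ : ∀ (L : List A) (f g : A → Carrier) →
                 sumL (map (λ x → f x + g x) L) ≈ sumL (map f L) + sumL (map g L)
    sumL-map-+ []      f g = sym (+-identityˡ 0#)
    sumL-map-+ (x ∷ L) f g = trans (+-congˡ (sumL-map-+ L f g)) (+-interchange _ _ _ _)

    sumL-map-* : ∀ (L : List A) z (f : A → Carrier) → sumL (map (λ x → z * f x) L) ≈ z * sumL (map f L)
    sumL-map-* []      z f = sym (zeroʳ z)
    sumL-map-* (x ∷ L) z f = trans (+-congˡ (sumL-map-* L z f)) (sym (distribˡ z _ _))

    sumL-map-zero : ∀ (L : List A) {f : A → Carrier} → (∀ x → f x ≈ 0#) → sumL (map f L) ≈ 0#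
    sumL-map-zero []      f≈0 = refl
    sumL-map-zero (x ∷ L) f≈0 = trans (+-cong (f≈0 x) (sumL-map-zero L f≈0)) (+-identityˡ 0#)

    sumL-map-mono-≤ : ∀ (L : List A) {f g : A → Carrier} → (∀ x → f x ≤ g x) → sumL (map f L) ≤ sumL (map g L)
    sumL-map-mono-≤ []      f≤g = ≤-refl
    sumL-map-mono-≤ (x ∷ L) f≤g = +-mono-≤ (f≤g x) (sumL-map-mono-≤ L f≤g)

    sumL-map-nonneg : ∀ (L : List A) {f : A → Carrier} → (∀ x → 0# ≤ f x) → 0# ≤ sumL (map f L)
    sumL-map-nonneg []      0≤f = ≤-refl
    sumL-map-nonneg (x ∷ L) 0≤f = +-nonneg (0≤f x) (sumL-map-nonneg L 0≤f)

    ∑-sumL-map-comm : ∀ {k} (L : List A) (f : Fin k → A → Carrier) →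
                      ∑[ j < k ] sumL (map (f j) L) ≈ sumL (map (λ x → ∑[ j < k ] f j x) L)
    ∑-sumL-map-comm {k} []      f = sum-replicate-zero k
    ∑-sumL-map-comm {k} (x ∷ L) f =
      trans (∑-distrib-+ (λ j → f j x) (λ j → sumL (map (f j) L))) (+-congˡ (∑-sumL-map-comm L f))

  sum-tail-select : ∀ {k} s (R : Subset k) x →
    ∑[ j < k ] (if ⌊ suc j ∈? s ∷ R ⌋ then x else 0#) ≡ ∑[ j < k ] (if ⌊ j ∈? R ⌋ then x else 0#)
  sum-tail-select s R x = sum-cong-≗ (λ j → ≡.cong (if_then x else 0#) (⌊suc∈?∷⌋ j s R))

  sum-select : ∀ {k} (R : Subset k) x → ∑[ j < k ] (if ⌊ j ∈? R ⌋ then x else 0#) ≈ fromℕ' ∣ R ∣ * x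
  sum-select []            x = sym (zeroˡ x)
  sum-select (outside ∷ R) x = begin-equality
    0# + ∑[ j < _ ] (if ⌊ suc j ∈? outside ∷ R ⌋ then x else 0#)
      ≡⟨ ≡.cong (0# +_) (sum-tail-select outside R x) ⟩
    0# + ∑[ j < _ ] (if ⌊ j ∈? R ⌋ then x else 0#)
      ≈⟨ +-identityˡ _ ⟩
    ∑[ j < _ ] (if ⌊ j ∈? R ⌋ then x else 0#)
      ≈⟨ sum-select R x ⟩
    fromℕ' ∣ R ∣ * x
      ∎
  sum-select (inside  ∷ R) x = begin-equality
    x + ∑[ j < _ ] (if ⌊ suc j ∈? inside ∷ R ⌋ then x else 0#)
      ≡⟨ ≡.cong (x +_) (sum-tail-select inside R x) ⟩
    x + ∑[ j < _ ] (if ⌊ j ∈? R ⌋ then x else 0#)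
      ≈⟨ +-congˡ (sum-select R x) ⟩
    x + fromℕ' ∣ R ∣ * x
      ≈⟨ +-congʳ (*-identityˡ x) ⟨
    1# * x + fromℕ' ∣ R ∣ * x
      ≈⟨ distribʳ x 1# (fromℕ' ∣ R ∣) ⟨
    (1# + fromℕ' ∣ R ∣) * x
      ∎

  complement-≤ : ∀ {a b c d} → a + d ≈ b → b - c ≤ a → d ≤ c
  complement-≤ {a} {b} {c} {d} a+d≈b b-c≤a = 0≤y-x⇒x≤y (begin
    0#                 ≤⟨ x≤y⇒0≤y-x b-c≤a ⟩
    a - (b - c)        ≈⟨ +-congˡ (-‿cong (+-congʳ a+d≈b)) ⟨
    a - ((a + d) - c)  ≈⟨ solve 3 (λ a c d → a :- ((a :+ d) :- c) := c :- d) refl a c d ⟩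
    c - d              ∎)

  fromℕ'-double : ∀ k → fromℕ' (2 ℕ.* k) ≈ fromℕ' k + fromℕ' k
  fromℕ'-double k = trans (fromℕ'-+ k (k ℕ.+ 0)) (+-congˡ (trans (fromℕ'-+ k 0) (+-identityʳ _)))

  square-shift-≤ : ∀ {c x y} p → 0# ≤ x → x ≤ c → 0# ≤ y → y ≤ c →
                   (p - (x - y)) ² ≤ p ² + ((c - (p + p)) * x + (c + (p + p)) * y)
  square-shift-≤ {c} {x} {y} p 0≤x x≤c 0≤y y≤c = 0≤y-x⇒x≤y (begin
    0#
      ≤⟨ +-nonneg (*-nonneg 0≤x (x≤y⇒0≤y-x x≤c))
                  (+-nonneg (*-nonneg 0≤y (x≤y⇒0≤y-x y≤c)) (*-nonneg (+-nonneg 0≤x 0≤x) 0≤y)) ⟩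
    x * (c - x) + (y * (c - y) + (x + x) * y)
      ≈⟨ solve 4 (λ p x y c → x :* (c :- x) :+ (y :* (c :- y) :+ (x :+ x) :* y)
                  := (p :* p :+ ((c :- (p :+ p)) :* x :+ (c :+ (p :+ p)) :* y)) :- (p :- (x :- y)) :* (p :- (x :- y)))
                 refl p x y c ⟩
    (p ² + ((c - (p + p)) * x + (c + (p + p)) * y)) - (p - (x - y)) ²
      ∎)

  cross-terms-≤ : ∀ {u v c t} → u ≤ 1# → v ≤ 1# → 0# ≤ c → 0# ≤ t →
                  (c - ((u - v) + (u - v))) * (t * u) + (c + ((u - v) + (u - v))) * (t * v)
                    ≤ (- (t + t)) * (u - v) ² + (t + t) * c
  cross-terms-≤ {u} {v} {c} {t} u≤1 v≤1 0≤c 0≤t = begin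
    (c - ((u - v) + (u - v))) * (t * u) + (c + ((u - v) + (u - v))) * (t * v)
      ≈⟨ solve 4 (λ u v c t → (c :- ((u :- v) :+ (u :- v))) :* (t :* u) :+ (c :+ ((u :- v) :+ (u :- v))) :* (t :* v)
                  := c :* (t :* u :+ t :* v) :+ (:- (t :+ t)) :* ((u :- v) :* (u :- v)))
                 refl u v c t ⟩
    c * (t * u + t * v) + (- (t + t)) * (u - v) ²
      ≤⟨ +-monoˡ-≤ _ (*-monoˡ-≤-nonneg 0≤c (+-mono-≤ (scaled-≤ u≤1) (scaled-≤ v≤1))) ⟩
    c * (t + t) + (- (t + t)) * (u - v) ²
      ≈⟨ solve 4 (λ u v c t → c :* (t :+ t) :+ (:- (t :+ t)) :* ((u :- v) :* (u :- v))
                  := (:- (t :+ t)) :* ((u :- v) :* (u :- v)) :+ (t :+ t) :* c)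
                 refl u v c t ⟩
    (- (t + t)) * (u - v) ² + (t + t) * c
      ∎
    where
    scaled-≤ : ∀ {z} → z ≤ 1# → t * z ≤ t
    scaled-≤ z≤1 = ≤-trans (*-monoˡ-≤-nonneg 0≤t z≤1) (≤-reflexive (*-identityʳ t))

  ∑-affine : ∀ {k} s t d (q : Fin k → Carrier) →
             ∑[ i < k ] (s * q i + ((- t) * q i + t * d)) ≈ s * sum q - t * (sum q - fromℕ' k * d)
  ∑-affine {k} s t d q = begin-equality
    ∑[ i < k ] (s * q i + ((- t) * q i + t * d))
      ≈⟨ ∑-distrib-+ (λ i → s * q i) (λ i → (- t) * q i + t * d) ⟩
    ∑[ i < k ] (s * q i) + ∑[ i < k ] ((- t) * q i + t * d)
      ≈⟨ +-cong (sym (*-distribˡ-sum s q)) (∑-distrib-+ (λ i → (- t) * q i) (λ _ → t * d)) ⟩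
    s * sum q + (∑[ i < k ] ((- t) * q i) + ∑[ i < k ] (t * d))
      ≈⟨ +-congˡ (+-cong (sym (*-distribˡ-sum (- t) q)) (sum-const k (t * d))) ⟩
    s * sum q + ((- t) * sum q + fromℕ' k * (t * d))
      ≈⟨ solve 5 (λ s t d Q K → s :* Q :+ ((:- t) :* Q :+ K :* (t :* d)) := s :* Q :- t :* (Q :- K :* d))
                 refl s t d (sum q) (fromℕ' k) ⟩
    s * sum q - t * (sum q - fromℕ' k * d)
      ∎

  through : ∀ {n} → Fin n → (Subset n → Carrier) → Subset n → Carrier
  through j h R = if ⌊ j ∈? R ⌋ then h R else 0#

  wDegree : ∀ {n} (r : ℕ) → (Subset n → Carrier) → Subset n → Fin n → Carrier
  wDegree r h S j = wStar 𝔽 r (through j h) S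

  module _ {n : ℕ} (r : ℕ) where

    wStar-remove : ∀ h (S : Subset n) j → wStar 𝔽 r h S ≈ wStar 𝔽 r h (S ─ ⁅ j ⁆) + wDegree r h S j
    wStar-remove h S j =
      trans (sumL-map-cong (allSubsets n) (λ R → split ⌊ ∣ R ∣ ℕ.≟ r ⌋ R)) (sumL-map-+ (allSubsets n) _ _)
      where
      split : ∀ t R → (if t ∧ ⌊ R ⊆? S ⌋ then h R else 0#)
                      ≈ (if t ∧ ⌊ R ⊆? S ─ ⁅ j ⁆ ⌋ then h R else 0#)
                        + (if t ∧ ⌊ R ⊆? S ⌋ then (if ⌊ j ∈? R ⌋ then h R else 0#) else 0#)
      split false R = sym (+-identityˡ 0#)
      split true  R with R ⊆? S ─ ⁅ j ⁆ | R ⊆? S | j ∈? R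
      ... | yes R⊆S-j | yes _   | yes j∈R = ⊥-elim (proj₂ (Equivalence.to ⊆─⁅⁆⇔ R⊆S-j) j∈R)
      ... | yes _     | yes _   | no  _   = sym (+-identityʳ _)
      ... | yes R⊆S-j | no  R⊈S | _       = ⊥-elim (R⊈S (proj₁ (Equivalence.to ⊆─⁅⁆⇔ R⊆S-j)))
      ... | no  _     | yes _   | yes _   = sym (+-identityˡ _)
      ... | no  R⊈S-j | yes R⊆S | no  j∉R = ⊥-elim (R⊈S-j (Equivalence.from ⊆─⁅⁆⇔ (R⊆S , j∉R)))
      ... | no  _     | no  _   | _       = sym (+-identityˡ 0#)

    wStar-─⁅⁆ : ∀ h (S : Subset n) j → wStar 𝔽 r h (S ─ ⁅ j ⁆) ≈ wStar 𝔽 r h S - wDegree r h S j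
    wStar-─⁅⁆ h S j = begin-equality
      wStar 𝔽 r h (S ─ ⁅ j ⁆)
        ≈⟨ solve 2 (λ a d → a := (a :+ d) :- d) refl _ (wDegree r h S j) ⟩
      (wStar 𝔽 r h (S ─ ⁅ j ⁆) + wDegree r h S j) - wDegree r h S j
        ≈⟨ +-congʳ (wStar-remove h S j) ⟨
      wStar 𝔽 r h S - wDegree r h S j
        ∎

    wDegree-∉ : ∀ h (S : Subset n) {j} → j ∉ S → wDegree r h S j ≈ 0#
    wDegree-∉ h S {j} j∉S = sumL-map-zero (allSubsets n) (λ R → vanish ⌊ ∣ R ∣ ℕ.≟ r ⌋ R)
      where
      vanish : ∀ t R → (if t ∧ ⌊ R ⊆? S ⌋ then (if ⌊ j ∈? R ⌋ then h R else 0#) else 0#) ≈ 0#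
      vanish false R = refl
      vanish true  R with R ⊆? S | j ∈? R
      ... | yes R⊆S | yes j∈R = ⊥-elim (j∉S (R⊆S j∈R))
      ... | yes _   | no  _   = refl
      ... | no  _   | _       = refl

    sum-wDegree : ∀ h (S : Subset n) → ∑[ j < n ] wDegree r h S j ≈ fromℕ' r * wStar 𝔽 r h S
    sum-wDegree h S = begin-equality
      ∑[ j < n ] wDegree r h S j
        ≈⟨ ∑-sumL-map-comm {k = n} (allSubsets n) _ ⟩
      sumL (map (λ R → ∑[ j < n ] (if in-S R then through j h R else 0#)) (allSubsets n))
        ≈⟨ sumL-map-cong (allSubsets n) count ⟩
      sumL (map (λ R → fromℕ' r * (if in-S R then h R else 0#)) (allSubsets n))
        ≈⟨ sumL-map-* (allSubsets n) (fromℕ' r) _ ⟩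
      fromℕ' r * wStar 𝔽 r h S
        ∎
      where
      in-S : Subset n → Bool
      in-S R = ⌊ ∣ R ∣ ℕ.≟ r ⌋ ∧ ⌊ R ⊆? S ⌋

      count : ∀ R → ∑[ j < n ] (if in-S R then through j h R else 0#) ≈ fromℕ' r * (if in-S R then h R else 0#)
      count R with ∣ R ∣ ℕ.≟ r | R ⊆? S
      ... | yes ∣R∣≡r | yes _ = trans (sum-select R (h R)) (*-congʳ (reflexive (≡.cong fromℕ' ∣R∣≡r)))
      ... | yes _     | no  _ = trans (sum-replicate-zero n) (sym (zeroʳ _))
      ... | no  _     | _     = trans (sum-replicate-zero n) (sym (zeroʳ _))

    module _ {h : Subset n → Carrier} (h≥0 : ∀ R → ∣ R ∣ ≡ r → 0# ≤ h R) where

      wStar-nonneg : ∀ S → 0# ≤ wStar 𝔽 r h S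
      wStar-nonneg S = sumL-map-nonneg (allSubsets n) term-nonneg
        where
        term-nonneg : ∀ R → 0# ≤ (if ⌊ ∣ R ∣ ℕ.≟ r ⌋ ∧ ⌊ R ⊆? S ⌋ then h R else 0#)
        term-nonneg R with ∣ R ∣ ℕ.≟ r | R ⊆? S
        ... | yes ∣R∣≡r | yes _ = h≥0 R ∣R∣≡r
        ... | yes _     | no  _ = ≤-refl
        ... | no  _     | _     = ≤-refl

      wStar-mono : ∀ {S T} → S ⊆ T → wStar 𝔽 r h S ≤ wStar 𝔽 r h T
      wStar-mono {S} {T} S⊆T = sumL-map-mono-≤ (allSubsets n) term-mono
        where
        term-mono : ∀ R → (if ⌊ ∣ R ∣ ℕ.≟ r ⌋ ∧ ⌊ R ⊆? S ⌋ then h R else 0#)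
                          ≤ (if ⌊ ∣ R ∣ ℕ.≟ r ⌋ ∧ ⌊ R ⊆? T ⌋ then h R else 0#)
        term-mono R with ∣ R ∣ ℕ.≟ r | R ⊆? S | R ⊆? T
        ... | no  _     | _       | _       = ≤-refl
        ... | yes _     | yes _   | yes _   = ≤-refl
        ... | yes _     | yes R⊆S | no  R⊈T = ⊥-elim (R⊈T (⊆-trans R⊆S S⊆T))
        ... | yes ∣R∣≡r | no  _   | yes _   = h≥0 R ∣R∣≡r
        ... | yes _     | no  _   | no  _   = ≤-refl

      through-nonneg : ∀ j R → ∣ R ∣ ≡ r → 0# ≤ (if ⌊ j ∈? R ⌋ then h R else 0#)
      through-nonneg j R ∣R∣≡r with j ∈? R
      ... | yes _ = h≥0 R ∣R∣≡r
      ... | no  _ = ≤-refl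

    module _ {h : Subset n → Carrier} (hw : IsWeightedHypergraph 𝔽 n r h) where

      wStar-⊤ : wStar 𝔽 r h ⊤ ≈ 1#
      wStar-⊤ = trans (sumL-map-cong (allSubsets n) (λ R → reflexive (⊆⊤-term ⌊ ∣ R ∣ ℕ.≟ r ⌋ R))) (proj₂ hw)
        where
        ⊆⊤-term : ∀ t R → (if t ∧ ⌊ R ⊆? ⊤ ⌋ then h R else 0#) ≡ (if t then h R else 0#)
        ⊆⊤-term false R = ≡.refl
        ⊆⊤-term true  R with R ⊆? ⊤
        ... | yes _   = ≡.refl
        ... | no  R⊈⊤ = ⊥-elim (R⊈⊤ ⊆⊤)

      wStar-≤1 : ∀ S → wStar 𝔽 r h S ≤ 1#
      wStar-≤1 S = ≤-trans (wStar-mono (proj₁ hw) ⊆⊤) (≤-reflexive wStar-⊤)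

      wDegree-nonneg : ∀ S j → 0# ≤ wDegree r h S j
      wDegree-nonneg S j = wStar-nonneg (through-nonneg (proj₁ hw) j) S

      wDegree-≤ : ∀ {c} → (∀ j → 1# - c ≤ wStar 𝔽 r h (⊤ ─ ⁅ j ⁆)) → ∀ S j → wDegree r h S j ≤ c
      wDegree-≤ {c} hc S j = begin
        wDegree r h S j  ≤⟨ wStar-mono (through-nonneg (proj₁ hw) j) ⊆⊤ ⟩
        wDegree r h ⊤ j  ≤⟨ complement-≤ (trans (sym (wStar-remove h ⊤ j)) wStar-⊤) (hc j) ⟩
        c                ∎

  module _ (m : ℕ) {c : Carrier} (0≤c : 0# ≤ c) {n r : ℕ}
           (w : Fin (suc m) → Subset n → Carrier)
           (hw : ∀ i → IsWeightedHypergraph 𝔽 n r (w i))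
           (hc : ∀ i j → 1# - c ≤ wStar 𝔽 r (w i) (⊤ ─ ⁅ j ⁆))
           (S : Subset n) where

    private
      u : Fin m → Carrier
      u i = wStar 𝔽 r (w (inject₁ i)) S

      v : Carrier
      v = wStar 𝔽 r (w (fromℕ m)) S

      p : Fin m → Carrier
      p = φ 𝔽 r w S

      x : Fin m → Fin n → Carrier
      x i = wDegree r (w (inject₁ i)) S

      y : Fin n → Carrier
      y = wDegree r (w (fromℕ m)) S

      α β : Fin m → Carrier
      α i = c - (p i + p i)
      β i = c + (p i + p i)

      linear : Fin m → Fin n → Carrier
      linear i j = α i * x i j + β i * y j

    φ-remove : ∀ i j → φ 𝔽 r w (S ─ ⁅ j ⁆) i ≈ p i - (x i j - y j)
    φ-remove i j = begin-equality
      φ 𝔽 r w (S ─ ⁅ j ⁆) i        ≈⟨ +-cong (wStar-─⁅⁆ r _ S j) (-‿cong (wStar-─⁅⁆ r _ S j)) ⟩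
      (u i - x i j) - (v - y j)    ≈⟨ solve 4 (λ u x v y → (u :- x) :- (v :- y) := (u :- v) :- (x :- y))
                                             refl (u i) (x i j) v (y j) ⟩
      (u i - v) - (x i j - y j)    ∎

    removal-≤ : ∀ j → (if ⌊ j ∈? S ⌋ then normSq 𝔽 r w (S ─ ⁅ j ⁆) else 0#)
                      ≤ ∑[ i < m ] ((if ⌊ j ∈? S ⌋ then p i ² else 0#) + linear i j)
    removal-≤ j with j ∈? S
    ... | yes _ = begin
      normSq 𝔽 r w (S ─ ⁅ j ⁆)             ≡⟨ ΣFin≡sum (λ i → φ 𝔽 r w (S ─ ⁅ j ⁆) i ²) ⟩
      ∑[ i < m ] φ 𝔽 r w (S ─ ⁅ j ⁆) i ²   ≈⟨ sum-cong-≋ (λ i → *-cong (φ-remove i j) (φ-remove i j)) ⟩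
      ∑[ i < m ] (p i - (x i j - y j)) ²   ≤⟨ sum-mono-≤ (λ i → square-shift-≤ (p i) (x≥0 i) (x≤c i) y≥0 y≤c) ⟩
      ∑[ i < m ] (p i ² + linear i j)      ∎
      where
      x≥0 : ∀ i → 0# ≤ x i j
      x≥0 i = wDegree-nonneg r (hw (inject₁ i)) S j
      x≤c : ∀ i → x i j ≤ c
      x≤c i = wDegree-≤ r (hw (inject₁ i)) (hc (inject₁ i)) S j
      y≥0 : 0# ≤ y j
      y≥0 = wDegree-nonneg r (hw (fromℕ m)) S j
      y≤c : y j ≤ c
      y≤c = wDegree-≤ r (hw (fromℕ m)) (hc (fromℕ m)) S j
    ... | no j∉S = sum-nonneg (λ i → ≤-reflexive (sym (trans (+-identityˡ _) (linear≈0 i))))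
      where
      linear≈0 : ∀ i → linear i j ≈ 0#
      linear≈0 i = trans (+-cong (trans (*-congˡ (wDegree-∉ r _ S j∉S)) (zeroʳ _))
                                 (trans (*-congˡ (wDegree-∉ r _ S j∉S)) (zeroʳ _)))
                         (+-identityˡ 0#)

    ∑-removal-bound : ∀ i → ∑[ j < n ] ((if ⌊ j ∈? S ⌋ then p i ² else 0#) + linear i j)
                       ≈ fromℕ' ∣ S ∣ * p i ² + (α i * (fromℕ' r * u i) + β i * (fromℕ' r * v))
    ∑-removal-bound i = begin-equality
      ∑[ j < n ] ((if ⌊ j ∈? S ⌋ then p i ² else 0#) + linear i j)
        ≈⟨ ∑-distrib-+ (λ j → if ⌊ j ∈? S ⌋ then p i ² else 0#) (linear i) ⟩
      ∑[ j < n ] (if ⌊ j ∈? S ⌋ then p i ² else 0#) + ∑[ j < n ] linear i j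
        ≈⟨ +-cong (sum-select S (p i ²)) (∑-distrib-+ (λ j → α i * x i j) (λ j → β i * y j)) ⟩
      fromℕ' ∣ S ∣ * p i ² + (∑[ j < n ] (α i * x i j) + ∑[ j < n ] (β i * y j))
        ≈⟨ +-congˡ (+-cong (*-distribˡ-sum (α i) (x i)) (*-distribˡ-sum (β i) y)) ⟨
      fromℕ' ∣ S ∣ * p i ² + (α i * sum (x i) + β i * sum y)
        ≈⟨ +-congˡ (+-cong (*-congˡ (sum-wDegree r _ S)) (*-congˡ (sum-wDegree r _ S))) ⟩
      fromℕ' ∣ S ∣ * p i ² + (α i * (fromℕ' r * u i) + β i * (fromℕ' r * v))
        ∎

    sumRemove-≤ : sumRemove 𝔽 r w S
                    ≤ fromℕ' ∣ S ∣ * normSq 𝔽 r w S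
                      - fromℕ' (2 ℕ.* r) * (normSq 𝔽 r w S - fromℕ' m * c)
    sumRemove-≤ = begin
      sumRemove 𝔽 r w S
        ≡⟨ ΣFin≡sum (λ j → if ⌊ j ∈? S ⌋ then normSq 𝔽 r w (S ─ ⁅ j ⁆) else 0#) ⟩
      ∑[ j < n ] (if ⌊ j ∈? S ⌋ then normSq 𝔽 r w (S ─ ⁅ j ⁆) else 0#)
        ≤⟨ sum-mono-≤ removal-≤ ⟩
      ∑[ j < n ] ∑[ i < m ] ((if ⌊ j ∈? S ⌋ then p i ² else 0#) + linear i j)
        ≈⟨ ∑-comm (λ j i → (if ⌊ j ∈? S ⌋ then p i ² else 0#) + linear i j) ⟩
      ∑[ i < m ] ∑[ j < n ] ((if ⌊ j ∈? S ⌋ then p i ² else 0#) + linear i j)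
        ≈⟨ sum-cong-≋ ∑-removal-bound ⟩
      ∑[ i < m ] (s * p i ² + (α i * (ρ * u i) + β i * (ρ * v)))
        ≤⟨ sum-mono-≤ (λ i → +-monoʳ-≤ _ (cross-terms-≤ (u≤1 i) v≤1 0≤c (fromℕ'-nonneg r))) ⟩
      ∑[ i < m ] (s * p i ² + ((- (ρ + ρ)) * p i ² + (ρ + ρ) * c))
        ≈⟨ ∑-affine s (ρ + ρ) c (λ i → p i ²) ⟩
      s * ∑[ i < m ] p i ² - (ρ + ρ) * (∑[ i < m ] p i ² - fromℕ' m * c)
        ≡⟨ ≡.cong (λ N → s * N - (ρ + ρ) * (N - fromℕ' m * c)) (ΣFin≡sum (λ i → p i ²)) ⟨
      s * normSq 𝔽 r w S - (ρ + ρ) * (normSq 𝔽 r w S - fromℕ' m * c)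
        ≈⟨ +-congˡ (-‿cong (*-congʳ (fromℕ'-double r))) ⟨
      s * normSq 𝔽 r w S - fromℕ' (2 ℕ.* r) * (normSq 𝔽 r w S - fromℕ' m * c)
        ∎
      where
      s ρ : Carrier
      s = fromℕ' ∣ S ∣
      ρ = fromℕ' r
      u≤1 : ∀ i → u i ≤ 1#
      u≤1 i = wStar-≤1 r (hw (inject₁ i)) S
      v≤1 : v ≤ 1#
      v≤1 = wStar-≤1 r (hw (fromℕ m)) S

lemma3p1 : ∀ {a ℓ₁ ℓ₂ : Level} (𝔽 : OrderedCommRing a ℓ₁ ℓ₂) →
  let open OrderedCommRing 𝔽 in
  (m : ℕ) → 1 ℕ.≤ m →
  (c : Carrier) → 0# < c → c + c < 1# →
  (n r : ℕ) → 1 ℕ.≤ r → r ℕ.≤ n →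
  (w : Fin (suc m) → Subset n → Carrier) →
  (∀ i → IsWeightedHypergraph 𝔽 n r (w i)) →
  (∀ i (j : Fin n) → 1# - c ≤ wStar 𝔽 r (w i) (⊤ ─ ⁅ j ⁆)) →
  (S : Subset n) → Nonempty S →
  sumRemove 𝔽 r w S
    ≤ fromℕ' ∣ S ∣ * normSq 𝔽 r w S
      - fromℕ' (2 ℕ.* r) * (normSq 𝔽 r w S - fromℕ' m * c)
lemma3p1 𝔽 m _ c (0≤c , _) _ n r _ _ w hw hc S _ = sumRemove-≤ 𝔽 m 0≤c w hw hc S
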